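{- Let $G=(V,E)$ be a graph, let $(T,\mathcal{X})$ be a rooted tree-cut decomposition of $G$ of width $k$, and let $t$ be a node of $T$. Let $\alpha_1,\alpha_2$ be two extracts of $Y_t$ such that $c(\alpha_1)>4e_t+c(\alpha_2)$. Then for every linear order $R_1$ of $Y_t$ which realizes $\alpha_1$ and every linear order $R$ of $V$ which is a linear superorder of $R_1$, there exists a linear order $R'$ of $V$ such that $\mathsf{imb}_{R'}<\mathsf{imb}_R$.
   Context: All graphs are finite and simple. A tree-cut decomposition of $G$ is a pair $(T,\mathcal{X})$ where $T$ is a tree and $\mathcal{X}=\{X_t : t\in V(T)\}$ is a family of pairwise disjoint, possibly empty, subsets of $V(G)$ whose union is $V(G)$; for a rooted decomposition, $Y_t$ is the union of the bags of the subtree rooted at $t$. (Width: for an edge $e$ of $T$, $\mathsf{cut}(e)$ is the set of edges of $G$ joining the unions of bags of the two components of $T-e$; the torso at $t$ is obtained by replacing the union of bags of each component of $T-t$ by a single vertex keeping incident edges as multi-edges; the 3-center is obtained by exhaustively suppressing non-bag vertices of degree $\le 2$ (delete, and if degree 2 join its two neighbours); the width is the maximum over edges of $|\mathsf{cut}(e)|$ and over nodes of the number of vertices of the 3-center of the torso.) $\partial(Y_t)$ is the set of vertices of $Y_t$ with a neighbour outside $Y_t$; for $v\in Y_t$, $\mathsf{adh}_t(v)$ is the number of neighbours of $v$ outside $Y_t$; $e_t$ is the number of edges with exactly one endpoint in $Y_t$. For a linear order $R$ of a vertex set $W$ and $v\in W$, $\lhd_R(v)$ and $\rhd_R(v)$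 are the numbers of neighbours of $v$ in $W$ occurring before, respectively after, $v$ in $R$, and $\mathsf{imb}_R(v)=|\rhd_R(v)-\lhd_R(v)|$; for $W=V$, $\mathsf{imb}_R=\sum_{v\in V}\mathsf{imb}_R(v)$. For sets $A\subseteq B$ with linear orders $f_A,f_B$, $f_B$ is a linear superorder of $f_A$ if the elements of $A$ occur in the same order in $f_A$ and $f_B$. An extract of $Y_t$ is a pair $(f,\tau)$ where $f$ is a linear order of $\partial(Y_t)$ and $\tau(v)\in\{ -\infty,-\mathsf{adh}_t(v),\dots,\mathsf{adh}_t(v),\infty\}$ for each $v\in\partial(Y_t)$. A linear order $R$ of $Y_t$ realizes $(f,\tau)$ if $R$ is a linear superorder of $f$ and for each $v\in\partial(Y_t)$: if $\tau(v)\in\mathbb{Z}$ then $\mathsf{imb}_R(v)=\tau(v)$; if $\tau(v)=-\infty$ then $\rhd_R(v)-\lhd_R(v)\le-\mathsf{adh}_t(v)-1$; if $\tau(v)=\infty$ then $\rhd_R(v)-\lhd_R(v)\ge\mathsf{adh}_t(v)+1$ (all counts taken within $G[Y_t]$). The cost $c(\alpha)$ of an extract $\alpha$ is the minimum of $\sum_{v\in Y_t}\mathsf{imb}_R(v)$ (in $G[Y_t]$) over all linear orders $R$ of $Y_t$ realizing $\alpha$, and $c(\alpha)=\infty$ if none exists. -}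

module Defs where

open import Data.Nat using (ℕ; zero; suc; _+_; _*_; _<_; _≤_)
open import Data.Bool using (Bool; true; false; _∧_; _xor_; not; if_then_else_)
open import Data.Fin using (Fin; toℕ)
open import Data.Fin.Properties using (_≟_)
open import Data.Integer as ℤ using (ℤ)
open import Data.List using (List; []; _∷_; _++_; length; filterᵇ; map; allFin; concatMap)
open import Data.Nat.ListAction using (sum)
open import Data.List.Membership.Propositional using (_∈_)
open import Data.List.Relation.Unary.Unique.Propositional using (Unique)
open import Data.List.Relation.Binary.Sublist.Propositional using (_⊆_)
open import Data.Product using (_×_; Σ; ∃; _,_)
open import Data.Unit using (⊤)
open import Data.Empty using (⊥)
open import Relation.Nullary using (yes; no; ¬_)
open import Relation.Nullary.Decidable using (⌊_⌋)
open import Relation.Binary.PropositionalEquality using (_≡_)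
open import Function.Bundles using (_⇔_)

record Graph (n : ℕ) : Set where
  field
    adj     : Fin n → Fin n → Bool
    adj-sym : ∀ u v → adj u v ≡ adj v u
    irrefl  : ∀ v → adj v v ≡ false
open Graph public

memb : {n : ℕ} → Fin n → List (Fin n) → Bool
memb v []       = false
memb v (x ∷ xs) = if ⌊ x ≟ v ⌋ then true else memb v xs

count : {A : Set} → (A → Bool) → List A → ℕ
count p xs = length (filterᵇ p xs)

IsLinOrd : {n : ℕ} → (Fin n → Set) → List (Fin n) → Set
IsLinOrd {n} W R = Unique R × (∀ (v : Fin n) → (v ∈ R) ⇔ W v)

before : {n : ℕ} → List (Fin n) → Fin n → List (Fin n)
before []       v = []
before (x ∷ xs) v with x ≟ v
... | yes _ = []
... | no  _ = x ∷ before xs v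

after : {n : ℕ} → List (Fin n) → Fin n → List (Fin n)
after []       v = []
after (x ∷ xs) v with x ≟ v
... | yes _ = xs
... | no  _ = after xs v

module _ {n : ℕ} (G : Graph n) where

  lhd : List (Fin n) → Fin n → ℕ
  lhd R v = count (adj G v) (before R v)

  rhd : List (Fin n) → Fin n → ℕ
  rhd R v = count (adj G v) (after R v)

  diff : List (Fin n) → Fin n → ℤ
  diff R v = ℤ.+ rhd R v ℤ.- ℤ.+ lhd R v

  imbV : List (Fin n) → Fin n → ℕ
  imbV R v = ℤ.∣ diff R v ∣

  imb : List (Fin n) → ℕ
  imb R = sum (map (imbV R) R)

data TCTree (n : ℕ) : Set where
  node : List (Fin n) → List (TCTree n) → TCTree n

mutual
  Yl : {n : ℕ} → TCTree n → List (Fin n)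
  Yl (node b ts) = b ++ Yls ts

  Yls : {n : ℕ} → List (TCTree n) → List (Fin n)
  Yls []       = []
  Yls (t ∷ ts) = Yl t ++ Yls ts

-- the bags are pairwise disjoint (and duplicate-free) and cover V
IsTreeCutDecomp : {n : ℕ} → TCTree n → Set
IsTreeCutDecomp {n} T = Unique (Yl T) × (∀ (v : Fin n) → v ∈ Yl T)

-- t is a node of T (t is the subtree of T rooted at that node)
data _IsNodeOf_ {n : ℕ} : TCTree n → TCTree n → Set where
  here  : ∀ {t} → t IsNodeOf t
  child : ∀ {t b ts s} → s ∈ ts → t IsNodeOf s → t IsNodeOf (node b ts)

module _ {n : ℕ} (G : Graph n) (t : TCTree n) where

  inY : Fin n → Bool
  inY v = memb v (Yl t)

  adh : Fin n → ℕ
  adh v = count (λ u → adj G v u ∧ not (inY u)) (allFin n)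

  InBoundary : Fin n → Set
  InBoundary v = (v ∈ Yl t) × (Σ (Fin n) λ u → (adj G v u ≡ true) × (inY u ≡ false))

  eT : ℕ
  eT = count (λ uv → edgeCross (Data.Product.proj₁ uv) (Data.Product.proj₂ uv))
             (concatMap (λ u → map (λ v → u , v) (allFin n)) (allFin n))
    where
      edgeCross : Fin n → Fin n → Bool
      edgeCross u v = ⌊ Data.Nat._<?_ (toℕ u) (toℕ v) ⌋ ∧ adj G u v ∧ (inY u xor inY v)

data Tau : Set where
  -∞  : Tau
  fin : ℤ → Tau
  +∞  : Tau

record Extract {n : ℕ} (G : Graph n) (t : TCTree n) : Set where
  field
    f      : List (Fin n)
    f-ord  : IsLinOrd (InBoundary G t) f
    τ      : Fin n → Tau      -- only the values on ∂(Y_t) are relevant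
    τ-rng  : ∀ v → InBoundary G t v → ∀ z → τ v ≡ fin z →
               ℤ.∣ z ∣ ≤ adh G t v
open Extract public

TauSat : Tau → ℤ → ℕ → Set
TauSat -∞      d a = d ℤ.≤ ℤ.- ℤ.+ (suc a)
TauSat (fin z) d a = d ≡ z
TauSat +∞      d a = ℤ.+ (suc a) ℤ.≤ d

Realizes : {n : ℕ} (G : Graph n) (t : TCTree n) → Extract G t → List (Fin n) → Set
Realizes G t α R =
  IsLinOrd (λ v → v ∈ Yl t) R ×
  (f α ⊆ R) ×
  (∀ v → v ∈ f α → TauSat (τ α v) (diff G R v) (adh G t v))

data Cost : Set where
  fin : ℕ → Cost
  ∞   : Cost

IsCost : {n : ℕ} (G : Graph n) (t : TCTree n) → Extract G t → Cost → Set
IsCost G t α (fin m) =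
  (Σ (List _) λ R → Realizes G t α R × imb G R ≡ m) ×
  (∀ R → Realizes G t α R → m ≤ imb G R)
IsCost G t α ∞ = ∀ R → ¬ Realizes G t α R

_>_+ᶜ_ : Cost → ℕ → Cost → Set
c₁      > k +ᶜ ∞      = ⊥
∞       > k +ᶜ fin m  = ⊤
fin m₁  > k +ᶜ fin m₂ = k + m₂ < m₁

module Submission where

-- Write p for membership in Y_t and O for the restriction of R to the complement of Y_t.
-- Restricting a linear order to one side of the cut changes the imbalance of each vertex by
-- at most its number of neighbours across the cut, and these numbers add up to 2 e_t.
-- Hence imb R ≥ imb R₁ + imb O − 2 e_t, whereas R′ = R₂ O, for an optimal realization R₂
-- of α₂, has imb R′ ≤ imb R₂ + imb O + 2 e_t. As imb R₁ ≥ c(α₁) > 4 e_t + c(α₂) = 4 e_t + imb R₂,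
-- imb R′ < imb R.

open import Defs
open import Data.Bool using (Bool; true; false; T; not; _∧_; _xor_)
open import Data.Bool.Properties using (T?; T-≡; not-involutive; xor-comm)
open import Data.Empty using (⊥-elim)
open import Data.Fin using (Fin; toℕ)
open import Data.Fin.Properties using (_≟_; toℕ-injective)
open import Data.Integer as ℤ using (ℤ; ∣_∣)
import Data.Integer.Properties as ℤ
open import Data.Integer.Tactic.RingSolver using () renaming (solve-∀ to solve-∀ℤ)
open import Data.List using (List; []; _∷_; _++_; length; map; filterᵇ; allFin; concatMap)
open import Data.List.Properties
  using (filter-accept; filter-reject; filter-all; filter-none; filter-++; filter-idem; filter-≐; map-cong; length-++; ++-identityʳ)
open import Data.List.Membership.Propositional using (_∈_)
open import Data.List.Membership.Propositional.Properties
  using (∈-filter⁺; ∈-filter⁻; ∈-allFin; ∈-++⁺ˡ; ∈-++⁺ʳ)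
open import Data.List.Membership.Propositional.Properties.WithK using (unique∧set⇒bag)
open import Data.List.Relation.Binary.BagAndSetEquality using (∼bag⇒↭)
open import Data.List.Relation.Binary.Permutation.Propositional using (_↭_)
open import Data.List.Relation.Binary.Permutation.Propositional.Properties using (filter-↭; map⁺; ↭-length)
open import Data.List.Relation.Binary.Sublist.Propositional using (_⊆_; []; _∷_; _∷ʳ_)
open import Data.List.Relation.Binary.Sublist.Propositional.Properties using (Any-resp-⊆)
open import Data.List.Relation.Unary.All as All using (All; _∷_)
open import Data.List.Relation.Unary.AllPairs using ([]; _∷_)
open import Data.List.Relation.Unary.Any using (here; there)
open import Data.List.Relation.Unary.Unique.Propositional using (Unique)
import Data.List.Relation.Unary.Unique.Propositional.Properties as Unique
open import Data.Nat using (ℕ; suc; _+_; _*_; _<_; _≤_; _<?_; z≤n; s≤s)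
open import Data.Nat.ListAction using (sum)
open import Data.Nat.ListAction.Properties using (sum-↭)
open import Data.Nat.Properties
  using (≤-refl; ≤-trans; ≤-reflexive; n≤1+n; +-mono-≤; +-monoʳ-≤; +-monoʳ-<; +-comm; +-assoc; +-identityʳ; +-cancelʳ-≤;
         +-cancelʳ-<; <-asym; ≮⇒≥; ≤-antisym; +-suc; module ≤-Reasoning)
open import Data.Nat.Tactic.RingSolver using (solve-∀)
open import Data.Product using (Σ; _×_; _,_; proj₁; proj₂)
open import Data.Unit using (⊤; tt)
open import Function using (_∘_; flip)
open import Function.Bundles using (_⇔_; mk⇔; Equivalence)
open import Function.Construct.Composition using (_⇔-∘_)
open import Function.Construct.Symmetry using (⇔-sym)
open import Relation.Binary.PropositionalEquality
open import Relation.Nullary using (yes; no; ¬_)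
open import Relation.Nullary.Decidable using (⌊_⌋)

∑ : {A : Set} → List A → (A → ℕ) → ℕ
∑ xs f = sum (map f xs)

infix 7 ∑
syntax ∑ xs (λ x → e) = ∑[ x ← xs ] e

𝟙 : Bool → ℕ
𝟙 true  = 1
𝟙 false = 0

T-not⇒¬T : ∀ {b} → T (not b) → ¬ T b
T-not⇒¬T {true} ()

¬T⇒T-not : ∀ {b} → ¬ T b → T (not b)
¬T⇒T-not {true}  ¬t = ¬t tt
¬T⇒T-not {false} _  = tt

module _ {A : Set} where

  count≡sum-𝟙 : (c : A → Bool) (xs : List A) → count c xs ≡ ∑ xs (𝟙 ∘ c)
  count≡sum-𝟙 c []       = refl
  count≡sum-𝟙 c (x ∷ xs) with c x
  ... | true  = cong suc (count≡sum-𝟙 c xs)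
  ... | false = count≡sum-𝟙 c xs

  count-cong : {c d : A → Bool} → (∀ u → c u ≡ d u) → (xs : List A) → count c xs ≡ count d xs
  count-cong c≗d xs =
    cong length (filter-≐ (T? ∘ _) (T? ∘ _) ((λ {u} → subst T (c≗d u)) , (λ {u} → subst T (sym (c≗d u)))) xs)

  count-++ : (c : A → Bool) (xs ys : List A) → count c (xs ++ ys) ≡ count c xs + count c ys
  count-++ c xs ys = trans (cong length (filter-++ (T? ∘ c) xs ys)) (length-++ (filterᵇ c xs))

  count-↭ : (c : A → Bool) {xs ys : List A} → xs ↭ ys → count c xs ≡ count c ys
  count-↭ c σ = ↭-length (filter-↭ (T? ∘ c) σ)

  count-filterᵇ : (c q : A → Bool) (xs : List A) → count c (filterᵇ q xs) ≡ count (λ u → c u ∧ q u) xs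
  count-filterᵇ c q []       = refl
  count-filterᵇ c q (x ∷ xs) with q x
  ... | false with c x
  ...   | true  = count-filterᵇ c q xs
  ...   | false = count-filterᵇ c q xs
  count-filterᵇ c q (x ∷ xs) | true with c x
  ...   | true  = cong suc (count-filterᵇ c q xs)
  ...   | false = count-filterᵇ c q xs

  count-∧-partition : (c q : A → Bool) (xs : List A) →
    count c xs ≡ count (λ u → c u ∧ q u) xs + count (λ u → c u ∧ not (q u)) xs
  count-∧-partition c q []       = refl
  count-∧-partition c q (x ∷ xs) with q x | c x
  ... | true  | true  = cong suc (count-∧-partition c q xs)
  ... | true  | false = count-∧-partition c q xs
  ... | false | true  = trans (cong suc (count-∧-partition c q xs)) (sym (+-suc _ _))
  ... | false | false = count-∧-partition c q xs

  ∑-+ : (f g : A → ℕ) (xs : List A) → ∑[ x ← xs ] (f x + g x) ≡ ∑ xs f + ∑ xs g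
  ∑-+ f g []       = refl
  ∑-+ f g (x ∷ xs) = trans (cong (f x + g x +_) (∑-+ f g xs)) (swap (f x) (g x) _ _)
    where
    swap : ∀ a b c d → a + b + (c + d) ≡ a + c + (b + d)
    swap = solve-∀

  ∑-mono : {f g : A → ℕ} (xs : List A) → (∀ {x} → x ∈ xs → f x ≤ g x) →
    ∑ xs f ≤ ∑ xs g
  ∑-mono []       f≤g = z≤n
  ∑-mono (x ∷ xs) f≤g = +-mono-≤ (f≤g (here refl)) (∑-mono xs (f≤g ∘ there))

  ∑-partition : (f : A → ℕ) (p : A → Bool) (xs : List A) →
    ∑ xs f ≡ ∑ (filterᵇ p xs) f + ∑ (filterᵇ (not ∘ p) xs) f
  ∑-partition f p []       = refl
  ∑-partition f p (x ∷ xs) with p x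
  ... | true  = trans (cong (f x +_) (∑-partition f p xs)) (sym (+-assoc (f x) _ _))
  ... | false = trans (cong (f x +_) (∑-partition f p xs)) (x+[y+z]≡y+[x+z] (f x) (∑ (filterᵇ p xs) f) _)
    where
    x+[y+z]≡y+[x+z] : ∀ a b c → a + (b + c) ≡ b + (a + c)
    x+[y+z]≡y+[x+z] = solve-∀

count-map : {A B : Set} (c : B → Bool) (g : A → B) (xs : List A) → count c (map g xs) ≡ count (c ∘ g) xs
count-map c g []       = refl
count-map c g (x ∷ xs) with c (g x)
... | true  = cong suc (count-map c g xs)
... | false = count-map c g xs

module _ {A B : Set} where

  ∑-swap : (h : A → B → ℕ) (xs : List A) (ys : List B) →
    ∑[ a ← xs ] ∑ ys (h a) ≡ ∑[ b ← ys ] ∑[ a ← xs ] h a b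
  ∑-swap h []       ys = sym (sum-zeros ys)
    where
    sum-zeros : (ys : List B) → ∑[ _ ← ys ] 0 ≡ 0
    sum-zeros []       = refl
    sum-zeros (_ ∷ ys) = sum-zeros ys
  ∑-swap h (x ∷ xs) ys = begin
    ∑ ys (h x) + ∑[ a ← xs ] ∑ ys (h a)
      ≡⟨ cong (∑ ys (h x) +_) (∑-swap h xs ys) ⟩
    ∑ ys (h x) + ∑[ b ← ys ] ∑[ a ← xs ] h a b
      ≡⟨ ∑-+ (h x) (λ b → ∑[ a ← xs ] h a b) ys ⟨
    ∑[ b ← ys ] (h x b + ∑[ a ← xs ] h a b) ∎
    where open ≡-Reasoning

  count-concatMap-pairs : (c : A × B → Bool) (xs : List A) (ys : List B) →
    count c (concatMap (λ a → map (λ b → a , b) ys) xs) ≡ ∑[ a ← xs ] count (λ b → c (a , b)) ys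
  count-concatMap-pairs c []       ys = refl
  count-concatMap-pairs c (x ∷ xs) ys = begin
    count c (map (λ b → x , b) ys ++ concatMap (λ a → map (λ b → a , b) ys) xs)
      ≡⟨ count-++ c (map (λ b → x , b) ys) _ ⟩
    count c (map (λ b → x , b) ys) + count c (concatMap (λ a → map (λ b → a , b) ys) xs)
      ≡⟨ cong₂ _+_ (count-map c (λ b → x , b) ys) (count-concatMap-pairs c xs ys) ⟩
    count (λ b → c (x , b)) ys + ∑[ a ← xs ] count (λ b → c (a , b)) ys ∎
    where open ≡-Reasoning

module _ {n : ℕ} where

  count-before+after≤count : (c : Fin n → Bool) (v : Fin n) (L : List (Fin n)) →
    count c (before L v) + count c (after L v) ≤ count c L
  count-before+after≤count c v []       = z≤n
  count-before+after≤count c v (x ∷ L) with x ≟ v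
  ... | yes _ with c x
  ...   | true  = n≤1+n _
  ...   | false = ≤-refl
  count-before+after≤count c v (x ∷ L) | no _ with c x
  ...   | true  = s≤s (count-before+after≤count c v L)
  ...   | false = count-before+after≤count c v L

  before-filterᵇ : (q : Fin n → Bool) {v : Fin n} → T (q v) → (L : List (Fin n)) →
    before (filterᵇ q L) v ≡ filterᵇ q (before L v)
  before-filterᵇ q qv []      = refl
  before-filterᵇ q {v} qv (x ∷ L) with q x in qx
  ... | true with x ≟ v
  ...   | yes _ = refl
  ...   | no  _ rewrite qx = cong (x ∷_) (before-filterᵇ q qv L)
  before-filterᵇ q {v} qv (x ∷ L) | false with x ≟ v
  ...   | yes refl = ⊥-elim (subst T qx qv)
  ...   | no  _ rewrite qx = before-filterᵇ q qv L

  after-filterᵇ : (q : Fin n → Bool) {v : Fin n} → T (q v) → (L : List (Fin n)) →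
    after (filterᵇ q L) v ≡ filterᵇ q (after L v)
  after-filterᵇ q qv []      = refl
  after-filterᵇ q {v} qv (x ∷ L) with q x in qx
  ... | true with x ≟ v
  ...   | yes _ = refl
  ...   | no  _ = after-filterᵇ q qv L
  after-filterᵇ q {v} qv (x ∷ L) | false with x ≟ v
  ...   | yes refl = ⊥-elim (subst T qx qv)
  ...   | no  _ = after-filterᵇ q qv L

  memb⇔∈ : {v : Fin n} (xs : List (Fin n)) → T (memb v xs) ⇔ v ∈ xs
  memb⇔∈ xs = mk⇔ (to xs) (from xs)
    where
    to : ∀ {v} xs → T (memb v xs) → v ∈ xs
    to {v} (x ∷ xs) m with x ≟ v
    ... | yes refl = here refl
    ... | no  _    = there (to xs m)
    from : ∀ {v} xs → v ∈ xs → T (memb v xs)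
    from {v} (x ∷ xs) m with x ≟ v
    ... | yes _ = tt
    from (x ∷ xs) (here refl) | no x≢v = ⊥-elim (x≢v refl)
    from (x ∷ xs) (there m)   | no _   = from xs m

  linOrd↭allFin : {L : List (Fin n)} → IsLinOrd (λ _ → ⊤) L → L ↭ allFin n
  linOrd↭allFin (uL , covers) = ∼bag⇒↭ (unique∧set⇒bag uL (Unique.allFin⁺ n)
    λ {v} → mk⇔ (λ _ → ∈-allFin v) (λ _ → Equivalence.from (covers v) tt))

  filterᵇ-unique-sublist : (p : Fin n → Bool) {xs ys : List (Fin n)} → Unique ys → xs ⊆ ys →
    (∀ {v} → v ∈ ys → T (p v) → v ∈ xs) → All (T ∘ p) xs → filterᵇ p ys ≡ xs
  filterᵇ-unique-sublist p []             []         _        _          = refl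
  filterᵇ-unique-sublist p (y∉ys ∷ uys) (y ∷ʳ xs⊆ys) complete pxs =
    trans (filter-reject (T? ∘ p) (λ py → All.lookup y∉ys (Any-resp-⊆ xs⊆ys (complete (here refl) py)) refl))
          (filterᵇ-unique-sublist p uys xs⊆ys (complete ∘ there) pxs)
  filterᵇ-unique-sublist p (x∉ys ∷ uys) (refl ∷ xs⊆ys) complete (px ∷ pxs) =
    trans (filter-accept (T? ∘ p) px) (cong (_ ∷_) (filterᵇ-unique-sublist p uys xs⊆ys complete′ pxs))
    where
    complete′ : ∀ {v} → v ∈ _ → T (p v) → v ∈ _
    complete′ m pv with complete (there m) pv
    ... | here refl = ⊥-elim (All.lookup x∉ys m refl)
    ... | there m′  = m′

  filterᵇ-linOrd-suborder : (p : Fin n → Bool) {R₁ R : List (Fin n)} →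
    IsLinOrd (λ _ → ⊤) R → IsLinOrd (T ∘ p) R₁ → R₁ ⊆ R → filterᵇ p R ≡ R₁
  filterᵇ-linOrd-suborder p (uR , _) (_ , inside⇔) R₁⊆R =
    filterᵇ-unique-sublist p uR R₁⊆R (λ {v} _ → Equivalence.from (inside⇔ v))
                           (All.tabulate (λ {v} → Equivalence.to (inside⇔ v)))

  isLinOrd-⇔ : {W W′ : Fin n → Set} → (∀ v → W v ⇔ W′ v) → {R : List (Fin n)} → IsLinOrd W R → IsLinOrd W′ R
  isLinOrd-⇔ W⇔W′ (uR , R⇔W) = uR , λ v → W⇔W′ v ⇔-∘ R⇔W v

∣i∣≤∣i+j∣+∣j∣ : ∀ i j → ∣ i ∣ ≤ ∣ i ℤ.+ j ∣ + ∣ j ∣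
∣i∣≤∣i+j∣+∣j∣ i j = subst (λ k → ∣ k ∣ ≤ ∣ i ℤ.+ j ∣ + ∣ j ∣) (i+j-j≡i i j) (ℤ.∣i-j∣≤∣i∣+∣j∣ (i ℤ.+ j) j)
  where
  i+j-j≡i : ∀ i j → i ℤ.+ j ℤ.- j ≡ i
  i+j-j≡i = solve-∀ℤ

module _ {n : ℕ} (G : Graph n) where

  crosses : (Fin n → Bool) → Fin n → Fin n → Bool
  crosses p u w = adj G u w ∧ (p u xor p w)

  crossDeg : (Fin n → Bool) → List (Fin n) → Fin n → ℕ
  crossDeg p L v = count (crosses p v) L

  -- Spelled exactly like eT, so that eT G t is cutSize G (inY G t) by definition.
  cutSize : (Fin n → Bool) → ℕ
  cutSize p = count (λ uw → ⌊ toℕ (proj₁ uw) <? toℕ (proj₂ uw) ⌋ ∧ crosses p (proj₁ uw) (proj₂ uw))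
                    (concatMap (λ u → map (λ w → u , w) (allFin n)) (allFin n))

  module _ (q : Fin n → Bool) (L : List (Fin n)) {v : Fin n} (qv : T (q v)) where

    private
      outside : List (Fin n) → ℕ
      outside = count (λ u → adj G v u ∧ not (q u))

      shift : ℤ
      shift = ℤ.+ outside (after L v) ℤ.- ℤ.+ outside (before L v)

      count-adj-split : (K : List (Fin n)) → count (adj G v) K ≡ count (adj G v) (filterᵇ q K) + outside K
      count-adj-split K = trans (count-∧-partition (adj G v) q K)
                                (cong (_+ outside K) (sym (count-filterᵇ (adj G v) q K)))

      lhd-filterᵇ : lhd G L v ≡ lhd G (filterᵇ q L) v + outside (before L v)
      lhd-filterᵇ = trans (count-adj-split (before L v))
                          (cong (λ K → count (adj G v) K + outside (before L v)) (sym (before-filterᵇ q qv L)))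

      rhd-filterᵇ : rhd G L v ≡ rhd G (filterᵇ q L) v + outside (after L v)
      rhd-filterᵇ = trans (count-adj-split (after L v))
                          (cong (λ K → count (adj G v) K + outside (after L v)) (sym (after-filterᵇ q qv L)))

      diff-filterᵇ : diff G L v ≡ diff G (filterᵇ q L) v ℤ.+ shift
      diff-filterᵇ = begin
        ℤ.+ rhd G L v ℤ.- ℤ.+ lhd G L v
          ≡⟨ cong₂ (λ r l → ℤ.+ r ℤ.- ℤ.+ l) rhd-filterᵇ lhd-filterᵇ ⟩
        ℤ.+ (r + b) ℤ.- ℤ.+ (l + a)
          ≡⟨ cong₂ ℤ._-_ (ℤ.pos-+ r b) (ℤ.pos-+ l a) ⟩
        (ℤ.+ r ℤ.+ ℤ.+ b) ℤ.- (ℤ.+ l ℤ.+ ℤ.+ a)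
          ≡⟨ regroup (ℤ.+ r) (ℤ.+ l) (ℤ.+ b) (ℤ.+ a) ⟩
        diff G (filterᵇ q L) v ℤ.+ shift ∎
        where
        open ≡-Reasoning
        r l a b : ℕ
        r = rhd G (filterᵇ q L) v
        l = lhd G (filterᵇ q L) v
        a = outside (before L v)
        b = outside (after L v)
        regroup : ∀ r l b a → (r ℤ.+ b) ℤ.- (l ℤ.+ a) ≡ (r ℤ.- l) ℤ.+ (b ℤ.- a)
        regroup = solve-∀ℤ

      ∣shift∣≤crossDeg : ∣ shift ∣ ≤ crossDeg q L v
      ∣shift∣≤crossDeg = begin
        ∣ shift ∣
          ≤⟨ ℤ.∣i-j∣≤∣i∣+∣j∣ (ℤ.+ outside (after L v)) (ℤ.+ outside (before L v)) ⟩
        outside (after L v) + outside (before L v)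
          ≡⟨ +-comm (outside (after L v)) (outside (before L v)) ⟩
        outside (before L v) + outside (after L v)
          ≤⟨ count-before+after≤count _ v L ⟩
        outside L
          ≡⟨ count-cong (λ u → cong (λ b → adj G v u ∧ (b xor q u)) (Equivalence.to T-≡ qv)) L ⟨
        crossDeg q L v ∎
        where open ≤-Reasoning

    imbV-≤-imbV-filterᵇ : imbV G L v ≤ imbV G (filterᵇ q L) v + crossDeg q L v
    imbV-≤-imbV-filterᵇ = begin
      ∣ diff G L v ∣
        ≡⟨ cong ∣_∣ diff-filterᵇ ⟩
      ∣ diff G (filterᵇ q L) v ℤ.+ shift ∣
        ≤⟨ ℤ.∣i+j∣≤∣i∣+∣j∣ (diff G (filterᵇ q L) v) shift ⟩
      imbV G (filterᵇ q L) v + ∣ shift ∣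
        ≤⟨ +-monoʳ-≤ (imbV G (filterᵇ q L) v) ∣shift∣≤crossDeg ⟩
      imbV G (filterᵇ q L) v + crossDeg q L v ∎
      where open ≤-Reasoning

    imbV-filterᵇ-≤-imbV : imbV G (filterᵇ q L) v ≤ imbV G L v + crossDeg q L v
    imbV-filterᵇ-≤-imbV = begin
      imbV G (filterᵇ q L) v
        ≤⟨ ∣i∣≤∣i+j∣+∣j∣ (diff G (filterᵇ q L) v) shift ⟩
      ∣ diff G (filterᵇ q L) v ℤ.+ shift ∣ + ∣ shift ∣
        ≡⟨ cong (λ d → ∣ d ∣ + ∣ shift ∣) diff-filterᵇ ⟨
      imbV G L v + ∣ shift ∣
        ≤⟨ +-monoʳ-≤ (imbV G L v) ∣shift∣≤crossDeg ⟩
      imbV G L v + crossDeg q L v ∎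
      where open ≤-Reasoning

  module _ (q : Fin n → Bool) (L : List (Fin n)) where

    private
      side : List (Fin n)
      side = filterᵇ q L

      on-side : ∀ {v} → v ∈ side → T (q v)
      on-side m = proj₂ (∈-filter⁻ (T? ∘ q) {xs = L} m)

    ∑-imbV-≤-imb-filterᵇ : ∑ side (imbV G L) ≤ imb G side + ∑ side (crossDeg q L)
    ∑-imbV-≤-imb-filterᵇ = ≤-trans
      (∑-mono side (λ m → imbV-≤-imbV-filterᵇ q L (on-side m)))
      (≤-reflexive (∑-+ (imbV G side) (crossDeg q L) side))

    imb-filterᵇ-≤-∑-imbV : imb G side ≤ ∑ side (imbV G L) + ∑ side (crossDeg q L)
    imb-filterᵇ-≤-∑-imbV = ≤-trans
      (∑-mono side (λ m → imbV-filterᵇ-≤-imbV q L (on-side m)))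
      (≤-reflexive (∑-+ (imbV G L) (crossDeg q L) side))

  crossDeg-not : (p : Fin n → Bool) (L : List (Fin n)) (v : Fin n) → crossDeg (not ∘ p) L v ≡ crossDeg p L v
  crossDeg-not p L v = count-cong (λ u → cong (adj G v u ∧_) (not-xor-not (p v) (p u))) L
    where
    not-xor-not : ∀ a b → not a xor not b ≡ a xor b
    not-xor-not true  b = refl
    not-xor-not false b = not-involutive b

  module _ (p : Fin n → Bool) (L : List (Fin n)) where

    private
      inside outside : List (Fin n)
      inside  = filterᵇ p L
      outside = filterᵇ (not ∘ p) L

      crossings-partition : ∑ inside (crossDeg p L) + ∑ outside (crossDeg (not ∘ p) L) ≡ ∑ L (crossDeg p L)
      crossings-partition = begin
        ∑ inside (crossDeg p L) + ∑ outside (crossDeg (not ∘ p) L)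
          ≡⟨ cong (λ k → ∑ inside (crossDeg p L) + sum k) (map-cong (crossDeg-not p L) outside) ⟩
        ∑ inside (crossDeg p L) + ∑ outside (crossDeg p L)
          ≡⟨ ∑-partition (crossDeg p L) p L ⟨
        ∑ L (crossDeg p L) ∎
        where open ≡-Reasoning

    imb-≤-imb-restrictions : imb G L ≤ imb G inside + imb G outside + ∑ L (crossDeg p L)
    imb-≤-imb-restrictions = begin
      imb G L
        ≡⟨ ∑-partition (imbV G L) p L ⟩
      ∑ inside (imbV G L) + ∑ outside (imbV G L)
        ≤⟨ +-mono-≤ (∑-imbV-≤-imb-filterᵇ p L) (∑-imbV-≤-imb-filterᵇ (not ∘ p) L) ⟩
      (imb G inside + ∑ inside (crossDeg p L)) + (imb G outside + ∑ outside (crossDeg (not ∘ p) L))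
        ≡⟨ regroup (imb G inside) _ (imb G outside) _ ⟩
      imb G inside + imb G outside + (∑ inside (crossDeg p L) + ∑ outside (crossDeg (not ∘ p) L))
        ≡⟨ cong (imb G inside + imb G outside +_) crossings-partition ⟩
      imb G inside + imb G outside + ∑ L (crossDeg p L) ∎
      where
      open ≤-Reasoning
      regroup : ∀ a b c d → (a + b) + (c + d) ≡ a + c + (b + d)
      regroup = solve-∀

    imb-restrictions-≤-imb : imb G inside + imb G outside ≤ imb G L + ∑ L (crossDeg p L)
    imb-restrictions-≤-imb = begin
      imb G inside + imb G outside
        ≤⟨ +-mono-≤ (imb-filterᵇ-≤-∑-imbV p L) (imb-filterᵇ-≤-∑-imbV (not ∘ p) L) ⟩
      (∑ inside (imbV G L) + ∑ inside (crossDeg p L)) + (∑ outside (imbV G L) + ∑ outside (crossDeg (not ∘ p) L))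
        ≡⟨ regroup (∑ inside (imbV G L)) _ (∑ outside (imbV G L)) _ ⟩
      (∑ inside (imbV G L) + ∑ outside (imbV G L)) + (∑ inside (crossDeg p L) + ∑ outside (crossDeg (not ∘ p) L))
        ≡⟨ cong₂ _+_ (∑-partition (imbV G L) p L) (sym crossings-partition) ⟨
      imb G L + ∑ L (crossDeg p L) ∎
      where
      open ≤-Reasoning
      regroup : ∀ a b c d → (a + b) + (c + d) ≡ (a + c) + (b + d)
      regroup = solve-∀

  module _ (p : Fin n → Bool) where

    private
      V : List (Fin n)
      V = allFin n

      _≺_ : Fin n → Fin n → Bool
      u ≺ w = ⌊ toℕ u <? toℕ w ⌋

      forward : Fin n → Fin n → Bool
      forward u w = u ≺ w ∧ crosses p u w

      crosses-sym : ∀ u w → crosses p u w ≡ crosses p w u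
      crosses-sym u w = cong₂ _∧_ (adj-sym G u w) (xor-comm (p u) (p w))

      𝟙-crosses : ∀ v u → 𝟙 (crosses p v u) ≡ 𝟙 (forward v u) + 𝟙 (forward u v)
      𝟙-crosses v u with toℕ v <? toℕ u | toℕ u <? toℕ v
      ... | yes v<u | yes u<v = ⊥-elim (<-asym v<u u<v)
      ... | yes _   | no  _   = sym (+-identityʳ _)
      ... | no  _   | yes _   = cong 𝟙 (crosses-sym v u)
      ... | no  v≮u | no  u≮v with toℕ-injective (≤-antisym (≮⇒≥ u≮v) (≮⇒≥ v≮u))
      ...   | refl rewrite irrefl G v = refl

      cutSize≡∑∑ : cutSize p ≡ ∑[ u ← V ] ∑[ w ← V ] 𝟙 (forward u w)
      cutSize≡∑∑ = trans (count-concatMap-pairs _ V V) (cong sum (map-cong (λ u → count≡sum-𝟙 (forward u) V) V))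

    handshake : ∑[ v ← V ] crossDeg p V v ≡ 2 * cutSize p
    handshake = begin
      ∑[ v ← V ] count (crosses p v) V
        ≡⟨ cong sum (map-cong (λ v → count≡sum-𝟙 (crosses p v) V) V) ⟩
      ∑[ v ← V ] ∑[ u ← V ] 𝟙 (crosses p v u)
        ≡⟨ cong sum (map-cong (λ v → cong sum (map-cong (𝟙-crosses v) V)) V) ⟩
      ∑[ v ← V ] ∑[ u ← V ] (𝟙 (forward v u) + 𝟙 (forward u v))
        ≡⟨ cong sum (map-cong (λ v → ∑-+ (𝟙 ∘ forward v) (λ u → 𝟙 (forward u v)) V) V) ⟩
      ∑[ v ← V ] (∑[ u ← V ] 𝟙 (forward v u) + ∑[ u ← V ] 𝟙 (forward u v))
        ≡⟨ ∑-+ _ _ V ⟩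
      ∑[ v ← V ] ∑[ u ← V ] 𝟙 (forward v u) + ∑[ v ← V ] ∑[ u ← V ] 𝟙 (forward u v)
        ≡⟨ cong (∑[ v ← V ] ∑[ u ← V ] 𝟙 (forward v u) +_) (∑-swap (λ v u → 𝟙 (forward u v)) V V) ⟩
      ∑[ v ← V ] ∑[ u ← V ] 𝟙 (forward v u) + ∑[ u ← V ] ∑[ v ← V ] 𝟙 (forward u v)
        ≡⟨ cong₂ _+_ cutSize≡∑∑ (trans (+-identityʳ (cutSize p)) cutSize≡∑∑) ⟨
      2 * cutSize p ∎
      where open ≡-Reasoning

    ∑-crossDeg≡2*cutSize : {L : List (Fin n)} → IsLinOrd (λ _ → ⊤) L → ∑ L (crossDeg p L) ≡ 2 * cutSize p
    ∑-crossDeg≡2*cutSize {L} linL = begin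
      ∑ L (crossDeg p L)
        ≡⟨ sum-↭ (map⁺ (crossDeg p L) L↭V) ⟩
      ∑ V (crossDeg p L)
        ≡⟨ cong sum (map-cong (λ v → count-↭ (crosses p v) L↭V) V) ⟩
      ∑ V (crossDeg p V)
        ≡⟨ handshake ⟩
      2 * cutSize p ∎
      where
      open ≡-Reasoning
      L↭V : L ↭ V
      L↭V = linOrd↭allFin linL

module _ {n : ℕ} (p : Fin n → Bool) where

  replaceInside : List (Fin n) → List (Fin n) → List (Fin n)
  replaceInside R₂ R = R₂ ++ filterᵇ (not ∘ p) R

  module _ {R₂ : List (Fin n)} (linR₂ : IsLinOrd (T ∘ p) R₂) where

    private
      R₂-inside : ∀ {v} → v ∈ R₂ → T (p v)
      R₂-inside {v} = Equivalence.to (proj₂ linR₂ v)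

      outside-of : ∀ {v} R → v ∈ filterᵇ (not ∘ p) R → ¬ T (p v)
      outside-of R m = T-not⇒¬T (proj₂ (∈-filter⁻ (T? ∘ not ∘ p) {xs = R} m))

    filterᵇ-replaceInside : (R : List (Fin n)) → filterᵇ p (replaceInside R₂ R) ≡ R₂
    filterᵇ-replaceInside R = begin
      filterᵇ p (R₂ ++ filterᵇ (not ∘ p) R)
        ≡⟨ filter-++ (T? ∘ p) R₂ _ ⟩
      filterᵇ p R₂ ++ filterᵇ p (filterᵇ (not ∘ p) R)
        ≡⟨ cong₂ _++_ (filter-all (T? ∘ p) (All.tabulate R₂-inside))
                      (filter-none (T? ∘ p) (All.tabulate (outside-of R))) ⟩
      R₂ ++ []
        ≡⟨ ++-identityʳ R₂ ⟩
      R₂ ∎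
      where open ≡-Reasoning

    filterᵇ-not-replaceInside : (R : List (Fin n)) → filterᵇ (not ∘ p) (replaceInside R₂ R) ≡ filterᵇ (not ∘ p) R
    filterᵇ-not-replaceInside R = begin
      filterᵇ (not ∘ p) (R₂ ++ filterᵇ (not ∘ p) R)
        ≡⟨ filter-++ (T? ∘ not ∘ p) R₂ _ ⟩
      filterᵇ (not ∘ p) R₂ ++ filterᵇ (not ∘ p) (filterᵇ (not ∘ p) R)
        ≡⟨ cong₂ _++_ (filter-none (T? ∘ not ∘ p) (All.tabulate (λ m → flip T-not⇒¬T (R₂-inside m))))
                      (filter-idem (T? ∘ not ∘ p) R) ⟩
      filterᵇ (not ∘ p) R ∎
      where open ≡-Reasoning

    replaceInside-isLinOrd : {R : List (Fin n)} → IsLinOrd (λ _ → ⊤) R → IsLinOrd (λ _ → ⊤) (replaceInside R₂ R)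
    replaceInside-isLinOrd {R} (uR , coversR) =
      Unique.++⁺ (proj₁ linR₂) (Unique.filter⁺ (T? ∘ not ∘ p) uR)
                 (λ (m₂ , m) → outside-of R m (R₂-inside m₂)) ,
      λ v → mk⇔ (λ _ → tt) (λ _ → covers v)
      where
      covers : ∀ v → v ∈ replaceInside R₂ R
      covers v with T? (p v)
      ... | yes pv = ∈-++⁺ˡ (Equivalence.from (proj₂ linR₂ v) pv)
      ... | no ¬pv = ∈-++⁺ʳ R₂ (∈-filter⁺ (T? ∘ not ∘ p) (Equivalence.from (coversR v) tt) (¬T⇒T-not ¬pv))

imb-replaceInside : {n : ℕ} (G : Graph n) (p : Fin n → Bool) {R R₂ : List (Fin n)} →
  IsLinOrd (λ _ → ⊤) R → IsLinOrd (T ∘ p) R₂ →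
  imb G (replaceInside p R₂ R) + imb G (filterᵇ p R) ≤ imb G R + imb G R₂ + 4 * cutSize G p
imb-replaceInside G p {R} {R₂} linR linR₂ = +-cancelʳ-≤ (imb G O) _ _ (begin
  imb G R′ + imb G I + imb G O
    ≡⟨ +-assoc (imb G R′) (imb G I) (imb G O) ⟩
  imb G R′ + (imb G I + imb G O)
    ≤⟨ +-mono-≤ upper lower ⟩
  (imb G R₂ + imb G O + 2 * c) + (imb G R + 2 * c)
    ≡⟨ regroup (imb G R₂) (imb G O) (imb G R) c ⟩
  imb G R + imb G R₂ + 4 * c + imb G O ∎)
  where
  open ≤-Reasoning
  R′ I O : List _
  R′ = replaceInside p R₂ R
  I  = filterᵇ p R
  O  = filterᵇ (not ∘ p) R
  c : ℕ
  c = cutSize G p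

  upper : imb G R′ ≤ imb G R₂ + imb G O + 2 * c
  upper = begin
    imb G R′
      ≤⟨ imb-≤-imb-restrictions G p R′ ⟩
    imb G (filterᵇ p R′) + imb G (filterᵇ (not ∘ p) R′) + ∑ R′ (crossDeg G p R′)
      ≡⟨ cong₂ (λ I′ O′ → imb G I′ + imb G O′ + ∑ R′ (crossDeg G p R′))
               (filterᵇ-replaceInside p linR₂ R) (filterᵇ-not-replaceInside p linR₂ R) ⟩
    imb G R₂ + imb G O + ∑ R′ (crossDeg G p R′)
      ≡⟨ cong (imb G R₂ + imb G O +_) (∑-crossDeg≡2*cutSize G p (replaceInside-isLinOrd p linR₂ linR)) ⟩
    imb G R₂ + imb G O + 2 * c ∎

  lower : imb G I + imb G O ≤ imb G R + 2 * c
  lower = begin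
    imb G I + imb G O
      ≤⟨ imb-restrictions-≤-imb G p R ⟩
    imb G R + ∑ R (crossDeg G p R)
      ≡⟨ cong (imb G R +_) (∑-crossDeg≡2*cutSize G p linR) ⟩
    imb G R + 2 * c ∎

  regroup : ∀ b o r c → (b + o + 2 * c) + (r + 2 * c) ≡ r + b + 4 * c + o
  regroup = solve-∀

imb-replaceInside-< : {n : ℕ} (G : Graph n) (p : Fin n → Bool) {R R₂ : List (Fin n)} →
  IsLinOrd (λ _ → ⊤) R → IsLinOrd (T ∘ p) R₂ →
  4 * cutSize G p + imb G R₂ < imb G (filterᵇ p R) → imb G (replaceInside p R₂ R) < imb G R
imb-replaceInside-< G p {R} {R₂} linR linR₂ gap = +-cancelʳ-< (imb G (filterᵇ p R)) _ _ (begin-strict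
  imb G (replaceInside p R₂ R) + imb G (filterᵇ p R)
    ≤⟨ imb-replaceInside G p linR linR₂ ⟩
  imb G R + imb G R₂ + 4 * cutSize G p
    ≡⟨ x+y+z≡x+[z+y] (imb G R) (imb G R₂) (4 * cutSize G p) ⟩
  imb G R + (4 * cutSize G p + imb G R₂)
    <⟨ +-monoʳ-< (imb G R) gap ⟩
  imb G R + imb G (filterᵇ p R) ∎)
  where
  open ≤-Reasoning
  x+y+z≡x+[z+y] : ∀ x y z → x + y + z ≡ x + (z + y)
  x+y+z≡x+[z+y] = solve-∀

lemma4p12 : (n : ℕ) (G : Graph n) (T : TCTree n) → IsTreeCutDecomp T →
    (t : TCTree n) → t IsNodeOf T →
    (α₁ α₂ : Extract G t) (c₁ c₂ : Cost) →
    IsCost G t α₁ c₁ → IsCost G t α₂ c₂ →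
    c₁ > 4 * eT G t +ᶜ c₂ →
    (R₁ : List (Fin n)) → Realizes G t α₁ R₁ →
    (R : List (Fin n)) → IsLinOrd (λ _ → ⊤) R → R₁ ⊆ R →
    Σ (List (Fin n)) λ R′ → IsLinOrd (λ _ → ⊤) R′ × (imb G R′ < imb G R)
lemma4p12 n G _ _ t _ α₁ α₂ c₁ ∞ _ _ ()
lemma4p12 n G _ _ t _ α₁ α₂ ∞ (fin m₂) unrealizable _ _ R₁ R₁-realizes _ _ _ =
  ⊥-elim (unrealizable R₁ R₁-realizes)
lemma4p12 n G _ _ t _ α₁ α₂ (fin m₁) (fin m₂) (_ , m₁-minimal) ((R₂ , R₂-realizes , imbR₂≡m₂) , _) gap
          R₁ R₁-realizes R linR R₁⊆R =
  replaceInside p R₂ R , replaceInside-isLinOrd p linR₂ linR , imb-replaceInside-< G p linR linR₂ gap′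
  where
  open ≤-Reasoning
  p : Fin n → Bool
  p = inY G t

  inY-linOrd : ∀ {R′} → IsLinOrd (λ v → v ∈ Yl t) R′ → IsLinOrd (T ∘ p) R′
  inY-linOrd = isLinOrd-⇔ (λ v → ⇔-sym (memb⇔∈ (Yl t)))

  linR₂ : IsLinOrd (T ∘ p) R₂
  linR₂ = inY-linOrd (proj₁ R₂-realizes)

  gap′ : 4 * cutSize G p + imb G R₂ < imb G (filterᵇ p R)
  gap′ = begin-strict
    4 * eT G t + imb G R₂  ≡⟨ cong (4 * eT G t +_) imbR₂≡m₂ ⟩
    4 * eT G t + m₂        <⟨ gap ⟩
    m₁                     ≤⟨ m₁-minimal R₁ R₁-realizes ⟩
    imb G R₁               ≡⟨ cong (imb G) (filterᵇ-linOrd-suborder p linR (inY-linOrd (proj₁ R₁-realizes)) R₁⊆R) ⟨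
    imb G (filterᵇ p R)    ∎
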